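{- Let $G$ be a $3$-connected graph with at least six vertices and an edge $e$, such that for some $n\ge4$, $G$ is obtained from a wheel with $n$ spokes by possibly doubling some spokes and splitting the hub by $e$, so that the resulting graph is simple and $3$-connected and both endvertices of $e$ have degree at least four. Then $G$ has a prism-minor using $e$.
   Context: Graphs are finite, without loops or parallel edges in the final graph. The hub of a wheel is the vertex adjacent to all rim vertices; spokes are edges at the hub; doubling a spoke means adding a parallel copy. A graph $H$ with edge $e=uv$ is obtained from $F$ by splitting vertex $w$ by $e$ if contracting $e$ in $H$ gives $F$ with $u,v$ identified into $w$. The prism is two disjoint triangles joined by a perfect matching. A minor $H$ of $G$ uses the edge $uv$ if $H$ has an edge $ab$ such that each of $a,b$ is either in $\{u,v\}$ or is obtained by identifying (via contractions) a set of vertices meeting $\{u,v\}$. -}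

module Defs where

open import Data.Nat using (ℕ; zero; suc; _≤_; _+_)
open import Data.Fin using (Fin; zero; suc; toℕ; fromℕ<)
open import Data.Fin.Properties using (_≟_)
open import Data.List using (List; []; _∷_; _++_; map; length; filter; lookup; allFin)
open import Data.List.Membership.Propositional using (_∈_)
open import Data.List.Relation.Binary.Permutation.Propositional using (_↭_)
open import Data.List.Relation.Binary.Pointwise using (Pointwise)
open import Data.Product using (Σ; ∃; _×_; _,_; proj₁; proj₂)
open import Data.Sum using (_⊎_)
open import Data.Bool using (Bool; true; false; if_then_else_)
open import Relation.Nullary using (¬_)
open import Relation.Nullary.Decidable using (_⊎-dec_)
open import Relation.Binary.PropositionalEquality using (_≡_; _≢_)
open import Data.Nat.Properties using (m<n⇒m<1+n)

-- (Multi)graphs: a vertex count and a list of edges (each edge is an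
-- ordered pair of endpoints, read as unordered).  Parallel edges are
-- repeated list entries; loops are entries (x , x).

Edge : ℕ → Set
Edge N = Fin N × Fin N

record Graph : Set where
  constructor mkGraph
  field
    N     : ℕ
    edges : List (Edge N)
open Graph public

EdgeEq : ∀ {N} → Edge N → Edge N → Set
EdgeEq (a , b) (c , d) = (a ≡ c × b ≡ d) ⊎ (a ≡ d × b ≡ c)

Adj : (G : Graph) → Fin (N G) → Fin (N G) → Set
Adj G x y = ((x , y) ∈ edges G) ⊎ ((y , x) ∈ edges G)

Simple : Graph → Set
Simple G =
  (∀ a b → (a , b) ∈ edges G → a ≢ b) ×
  (∀ (i j : Fin (length (edges G))) → i ≢ j →
     ¬ EdgeEq (lookup (edges G) i) (lookup (edges G) j))

-- degree: number of edges incident with x (for loopless graphs)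
degree : (G : Graph) → Fin (N G) → ℕ
degree G x = length (filter (λ e → (proj₁ e ≟ x) ⊎-dec (proj₂ e ≟ x)) (edges G))

data WalkIn (G : Graph) (S : Fin (N G) → Set) : Fin (N G) → Fin (N G) → Set where
  here : ∀ {x} → S x → WalkIn G S x x
  step : ∀ {x y z} → S x → Adj G x y → WalkIn G S y z → WalkIn G S x z

ConnectedSet : (G : Graph) → (Fin (N G) → Set) → Set
ConnectedSet G S = ∀ x y → S x → S y → WalkIn G S x y

ThreeConnected : Graph → Set
ThreeConnected G =
  Simple G × (4 ≤ N G) ×
  (∀ (a b : Fin (N G)) → ConnectedSet G (λ x → x ≢ a × x ≢ b))

-- Wheels with possibly doubled spokes.
-- Wheel with n spokes: vertex 0 is the hub, vertex (suc i) is the i-th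
-- rim vertex; rim edges (suc i , suc (i+1 mod n)); spokes (0 , suc i).

nextRim : ∀ {n} → Fin n → Fin n
nextRim {suc n} i with suc (toℕ i) Data.Nat.<? suc n
... | Relation.Nullary.yes p = fromℕ< p
... | Relation.Nullary.no _  = zero
  where open import Data.Nat using (_<?_)

open import Data.Nat using (_<?_)

rimEdges : (n : ℕ) → List (Edge (suc n))
rimEdges n = map (λ i → (suc i , suc (nextRim i))) (allFin n)

spokes : (n : ℕ) → List (Edge (suc n))
spokes n = map (λ i → (zero , suc i)) (allFin n)

extraSpokes : (n : ℕ) → (Fin n → Bool) → List (Edge (suc n))
extraSpokes n D = filterSel (allFin n)
  where
  filterSel : List (Fin n) → List (Edge (suc n))
  filterSel [] = []
  filterSel (i ∷ is) = if D i then (zero , suc i) ∷ filterSel is else filterSel is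

hub : ∀ {n} → Fin (suc n)
hub = zero

wheelDoubled : (n : ℕ) → (Fin n → Bool) → Graph
wheelDoubled n D = mkGraph (suc n) (rimEdges n ++ spokes n ++ extraSpokes n D)

SameEdgeMultiset : ∀ {N} → List (Edge N) → List (Edge N) → Set
SameEdgeMultiset xs ys = Σ _ λ zs → (xs ↭ zs) × Pointwise EdgeEq zs ys

-- H is obtained from F by splitting vertex w by the edge e = uv of H:
-- contracting e in H (deleting e, identifying u and v, keeping all other
-- edges) gives F, with the identified vertex becoming w.
SplitBy : (H F : Graph) → Fin (N F) → Fin (N H) → Fin (N H) → Set
SplitBy H F w u v =
  u ≢ v ×
  Σ (List (Edge (N H))) λ rest →
    (edges H ↭ ((u , v) ∷ rest)) ×
    Σ (Fin (N H) → Fin (N F)) λ φ →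
      (φ u ≡ w) × (φ v ≡ w) ×
      (∀ x y → φ x ≡ φ y → (x ≡ y) ⊎ ((x ≡ u ⊎ x ≡ v) × (y ≡ u ⊎ y ≡ v))) ×
      (∀ z → ∃ λ x → φ x ≡ z) ×
      SameEdgeMultiset (map (λ e → (φ (proj₁ e) , φ (proj₂ e))) rest) (edges F)

prismEdges : List (Fin 6 × Fin 6)
prismEdges =
  (f0 , f1) ∷ (f1 , f2) ∷ (f2 , f0) ∷
  (f3 , f4) ∷ (f4 , f5) ∷ (f5 , f3) ∷
  (f0 , f3) ∷ (f1 , f4) ∷ (f2 , f5) ∷ []
  where
  f0 f1 f2 f3 f4 f5 : Fin 6
  f0 = zero
  f1 = suc zero
  f2 = suc (suc zero)
  f3 = suc (suc (suc zero))
  f4 = suc (suc (suc (suc zero)))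
  f5 = suc (suc (suc (suc (suc zero))))

prism : Graph
prism = mkGraph 6 prismEdges

record MinorModel (M G : Graph) : Set₁ where
  field
    B         : Fin (N M) → Fin (N G) → Set
    nonempty  : ∀ i → ∃ λ x → B i x
    connected : ∀ i → ConnectedSet G (B i)
    disjoint  : ∀ i j x → B i x → B j x → i ≡ j
    edgesOK   : ∀ i j → (i , j) ∈ edges M →
                ∃ λ x → ∃ λ y → B i x × B j y × Adj G x y

HasMinorUsing : (M G : Graph) → Fin (N G) → Fin (N G) → Set₁
HasMinorUsing M G u v =
  Σ (MinorModel M G) λ μ → ∃ λ a → ∃ λ b →
    ((a , b) ∈ edges M ⊎ (b , a) ∈ edges M) ×
    MinorModel.B μ a u × MinorModel.B μ b v

-- Contracting uv turns G into the wheel, so every rim vertex is adjacent to u or to v, and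
-- since G is simple and u, v have degree at least four, each of u and v sees three distinct
-- rim vertices.  Comparing these triples yields four rim positions which, in cyclic order,
-- are two neighbours of u followed by two neighbours of v.  Cutting the rim into four arcs,
-- one through each of these positions, gives four connected beads arranged in a cycle; the
-- triangles u, A₁, A₂ and v, A₃, A₄ together with the edge uv form a prism model using uv.

module Submission where

open import Defs
open import Data.Nat using (ℕ; zero; suc; _+_; _≤_; _<_; _≤′_; ≤′-refl; ≤′-step; z≤n; s≤s; z<s; s<s; _<?_; _%_; NonZero)
open import Data.Nat.Properties
  using (≤-refl; ≤-trans; <-trans; <-irrefl; <⇒≤; <⇒≢; ≤-<-trans; <-≤-trans; ≤-total; ≤-pred;
         ≤⇒≤′; ≤′⇒≤; ≤∧≮⇒≡; n<1+n; m<n⇒m<1+n; <-cmp)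
open import Data.Nat.DivMod using (_mod_; m<n⇒m%n≡m; n%n≡0; m%n%n≡m%n; %-distribˡ-+)
open import Data.Fin using (Fin; zero; suc; toℕ)
open import Data.Fin.Patterns using (0F; 1F; 2F; 3F; 4F; 5F)
open import Data.Fin.Properties using (_≟_; toℕ-injective; toℕ-fromℕ<; toℕ<n; suc-injective)
open import Data.Bool using (Bool)
open import Data.Product using (∃; _×_; _,_; proj₁; proj₂)
open import Data.Sum using (_⊎_; inj₁; inj₂; [_,_])
import Data.Sum as Sum
open import Data.Empty using (⊥; ⊥-elim)
open import Data.List using (List; []; _∷_; map; filter; length)
open import Data.List.Properties using (length-map; tabulate-lookup)
open import Data.List.Relation.Unary.Any using (here; there)
open import Data.List.Relation.Unary.All using (All; []; _∷_)
import Data.List.Relation.Unary.All as All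
import Data.List.Relation.Unary.All.Properties as All
open import Data.List.Relation.Unary.AllPairs using (AllPairs; []; _∷_)
import Data.List.Relation.Unary.AllPairs.Properties as AllPairs
open import Data.List.Relation.Unary.Unique.Propositional using (Unique)
open import Data.List.Relation.Binary.Pointwise using (Pointwise; _∷_)
open import Data.List.Relation.Binary.Permutation.Propositional using (_↭_; ↭-sym)
open import Data.List.Relation.Binary.Permutation.Propositional.Properties using (∈-resp-↭)
open import Data.List.Membership.Propositional using (_∈_)
open import Data.List.Membership.Propositional.Properties using (∈-map⁺; ∈-map⁻; ∈-allFin; ∈-filter⁻; ∈-++⁺ˡ; ∈-++⁺ʳ)
open import Function using (_∘_; id)
open import Relation.Nullary using (¬_; yes; no)
open import Relation.Nullary.Decidable using (_⊎-dec_)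
open import Relation.Binary using (DecidableEquality; tri<; tri≈; tri>)
open import Relation.Binary.PropositionalEquality using (_≡_; _≢_; refl; sym; trans; cong; subst; subst₂; module ≡-Reasoning)

-- Walks and connected sets

Adj-sym : ∀ {G : Graph} {x y} → Adj G x y → Adj G y x
Adj-sym (inj₁ xy) = inj₂ xy
Adj-sym (inj₂ yx) = inj₁ yx

WalkIn-snoc : ∀ {G S x y z} → WalkIn G S x y → Adj G y z → S z → WalkIn G S x z
WalkIn-snoc (here sx) y~z sz = step sx y~z (here sz)
WalkIn-snoc (step sx x~x' walk) y~z sz = step sx x~x' (WalkIn-snoc walk y~z sz)

WalkIn-reverse : ∀ {G S x y} → WalkIn G S x y → WalkIn G S y x
WalkIn-reverse (here sx) = here sx
WalkIn-reverse {G} (step sx x~x' walk) = WalkIn-snoc (WalkIn-reverse walk) (Adj-sym {G} x~x') sx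

singleton-connected : ∀ {G : Graph} (w : Fin (N G)) → ConnectedSet G (_≡ w)
singleton-connected w x y refl refl = here refl

Touches : (G : Graph) → Fin (N G) → (Fin (N G) → Set) → Set
Touches G w S = ∃ λ x → S x × Adj G w x

Linked : (G : Graph) → (S T : Fin (N G) → Set) → Set
Linked G S T = ∃ λ x → ∃ λ y → S x × T y × Adj G x y

Linked-sym : ∀ {G S T} → Linked G S T → Linked G T S
Linked-sym {G} (x , y , sx , ty , x~y) = y , x , ty , sx , Adj-sym {G} x~y

Touches⇒Linked : ∀ {G w S} → Touches G w S → Linked G (_≡ w) S
Touches⇒Linked {w = w} (x , sx , w~x) = w , x , refl , sx , w~x

Segment : ∀ {V : Set} → (ℕ → V) → ℕ → ℕ → V → Set
Segment f lo hi x = ∃ λ t → lo ≤ t × t ≤ hi × f t ≡ x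

module _ (G : Graph) (f : ℕ → Fin (N G)) (path : ∀ t → Adj G (f t) (f (suc t))) where

  segment-walk : ∀ {lo hi s t} → s ≤′ t → lo ≤ s → t ≤ hi → WalkIn G (Segment f lo hi) (f s) (f t)
  segment-walk ≤′-refl lo≤s s≤hi = here (_ , lo≤s , s≤hi , refl)
  segment-walk {t = suc t} (≤′-step s≤′t) lo≤s t<hi =
    WalkIn-snoc (segment-walk s≤′t lo≤s (<⇒≤ t<hi)) (path t)
      (suc t , ≤-trans lo≤s (≤′⇒≤ (≤′-step s≤′t)) , t<hi , refl)

  segment-connected : ∀ lo hi → ConnectedSet G (Segment f lo hi)
  segment-connected lo hi _ _ (s , lo≤s , s≤hi , refl) (t , lo≤t , t≤hi , refl) with ≤-total s t
  ... | inj₁ s≤t = segment-walk (≤⇒≤′ s≤t) lo≤s t≤hi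
  ... | inj₂ t≤s = WalkIn-reverse (segment-walk (≤⇒≤′ t≤s) lo≤t s≤hi)

-- Prisms from four beads around an edge

next : Fin 4 → Fin 4
next 0F = 1F
next 1F = 2F
next 2F = 3F
next 3F = 0F

prev : Fin 4 → Fin 4
prev 0F = 3F
prev 1F = 0F
prev 2F = 1F
prev 3F = 2F

prev-next : ∀ a → prev (next a) ≡ a
prev-next 0F = refl
prev-next 1F = refl
prev-next 2F = refl
prev-next 3F = refl

next-injective : ∀ {a b} → next a ≡ next b → a ≡ b
next-injective {a} {b} e = trans (sym (prev-next a)) (trans (cong prev e) (prev-next b))

-- A model of the 4-cycle bead 0, bead 1, bead 2, bead 3 in G − {u, v}.
record Necklace (G : Graph) (u v : Fin (N G)) : Set₁ where
  field
    bead      : Fin 4 → Fin (N G) → Set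
    nonempty  : ∀ a → ∃ (bead a)
    connected : ∀ a → ConnectedSet G (bead a)
    disjoint  : ∀ a b x → bead a x → bead b x → a ≡ b
    avoids    : ∀ a x → bead a x → x ≢ u × x ≢ v
    linked    : ∀ a → Linked G (bead a) (bead (next a))

rotate : ∀ {G u v} → Necklace G u v → Necklace G u v
rotate necklace = record
  { bead      = bead ∘ next
  ; nonempty  = nonempty ∘ next
  ; connected = connected ∘ next
  ; disjoint  = λ a b x p q → next-injective (disjoint (next a) (next b) x p q)
  ; avoids    = avoids ∘ next
  ; linked    = linked ∘ next
  }
  where open Necklace necklace

data PrismPart : Set where
  u-part v-part : PrismPart
  bead-part     : Fin 4 → PrismPart

prismPart : Fin 6 → PrismPart
prismPart 0F = u-part
prismPart 1F = bead-part 1F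
prismPart 2F = bead-part 0F
prismPart 3F = v-part
prismPart 4F = bead-part 2F
prismPart 5F = bead-part 3F

prismVertex : PrismPart → Fin 6
prismVertex u-part         = 0F
prismVertex v-part         = 3F
prismVertex (bead-part 0F) = 2F
prismVertex (bead-part 1F) = 1F
prismVertex (bead-part 2F) = 4F
prismVertex (bead-part 3F) = 5F

prismVertex-prismPart : ∀ s → prismVertex (prismPart s) ≡ s
prismVertex-prismPart 0F = refl
prismVertex-prismPart 1F = refl
prismVertex-prismPart 2F = refl
prismVertex-prismPart 3F = refl
prismVertex-prismPart 4F = refl
prismVertex-prismPart 5F = refl

prismPart-injective : ∀ {s t} → prismPart s ≡ prismPart t → s ≡ t
prismPart-injective {s} {t} e =
  trans (sym (prismVertex-prismPart s)) (trans (cong prismVertex e) (prismVertex-prismPart t))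

module _ {G : Graph} {u v : Fin (N G)} (necklace : Necklace G u v) (u≢v : u ≢ v) where
  open Necklace necklace

  InPart : PrismPart → Fin (N G) → Set
  InPart u-part        = _≡ u
  InPart v-part        = _≡ v
  InPart (bead-part a) = bead a

  InPart-nonempty : ∀ p → ∃ (InPart p)
  InPart-nonempty u-part        = u , refl
  InPart-nonempty v-part        = v , refl
  InPart-nonempty (bead-part a) = nonempty a

  InPart-connected : ∀ p → ConnectedSet G (InPart p)
  InPart-connected u-part        = singleton-connected u
  InPart-connected v-part        = singleton-connected v
  InPart-connected (bead-part a) = connected a

  InPart-unique : ∀ p q {x} → InPart p x → InPart q x → p ≡ q
  InPart-unique u-part        u-part        _    _    = refl
  InPart-unique u-part        v-part        refl x≡v  = ⊥-elim (u≢v x≡v)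
  InPart-unique u-part        (bead-part b) refl u∈b  = ⊥-elim (proj₁ (avoids b u u∈b) refl)
  InPart-unique v-part        u-part        refl x≡u  = ⊥-elim (u≢v (sym x≡u))
  InPart-unique v-part        v-part        _    _    = refl
  InPart-unique v-part        (bead-part b) refl v∈b  = ⊥-elim (proj₂ (avoids b v v∈b) refl)
  InPart-unique (bead-part a) u-part        u∈a  refl = ⊥-elim (proj₁ (avoids a u u∈a) refl)
  InPart-unique (bead-part a) v-part        v∈a  refl = ⊥-elim (proj₂ (avoids a v v∈a) refl)
  InPart-unique (bead-part a) (bead-part b) x∈a  x∈b  = cong bead-part (disjoint a b _ x∈a x∈b)

  necklace⇒prism : Adj G u v →
    Touches G u (bead 0F) → Touches G u (bead 1F) → Touches G v (bead 2F) → Touches G v (bead 3F) →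
    HasMinorUsing prism G u v
  necklace⇒prism u~v u₀ u₁ v₂ v₃ = model , 0F , 3F , inj₁ u-v∈prism , refl , refl
    where
    u-v∈prism : (0F , 3F) ∈ edges prism
    u-v∈prism = there (there (there (there (there (there (here refl))))))

    branch : Fin 6 → Fin (N G) → Set
    branch s = InPart (prismPart s)

    realised : ∀ s t → (s , t) ∈ edges prism → Linked G (branch s) (branch t)
    realised _ _ (here refl)                                                 = Touches⇒Linked u₁
    realised _ _ (there (here refl))                                         = Linked-sym (linked 0F)
    realised _ _ (there (there (here refl)))                                 = Linked-sym (Touches⇒Linked u₀)
    realised _ _ (there (there (there (here refl))))                         = Touches⇒Linked v₂
    realised _ _ (there (there (there (there (here refl)))))                 = linked 2F
    realised _ _ (there (there (there (there (there (here refl))))))         = Linked-sym (Touches⇒Linked v₃)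
    realised _ _ (there (there (there (there (there (there (here refl))))))) = u , v , refl , refl , u~v
    realised _ _ (there (there (there (there (there (there (there (here refl)))))))) = linked 1F
    realised _ _ (there (there (there (there (there (there (there (there (here refl))))))))) = Linked-sym (linked 3F)
    realised _ _ (there (there (there (there (there (there (there (there (there ())))))))))

    model : MinorModel prism G
    model = record
      { B         = branch
      ; nonempty  = InPart-nonempty ∘ prismPart
      ; connected = InPart-connected ∘ prismPart
      ; disjoint  = λ s t x p q → prismPart-injective (InPart-unique (prismPart s) (prismPart t) p q)
      ; edgesOK   = realised
      }

-- Non-interleaved pairs on a cycle

data CyclicUUVV (U V : ℕ → Set) (i j k l : ℕ) : Set where
  uuvv : U i → U j → V k → V l → CyclicUUVV U V i j k l
  uvvu : U i → V j → V k → U l → CyclicUUVV U V i j k l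
  vvuu : V i → V j → U k → U l → CyclicUUVV U V i j k l
  vuuv : V i → U j → U k → V l → CyclicUUVV U V i j k l

CyclicUUVV-swap : ∀ {U V i j k l} → CyclicUUVV V U i j k l → CyclicUUVV U V i j k l
CyclicUUVV-swap (uuvv a b c d) = vvuu a b c d
CyclicUUVV-swap (uvvu a b c d) = vuuv a b c d
CyclicUUVV-swap (vvuu a b c d) = uuvv a b c d
CyclicUUVV-swap (vuuv a b c d) = uvvu a b c d

data Separated (n : ℕ) (U V : ℕ → Set) : Set where
  separated : ∀ {i j k l} → i < j → j < k → k < l → l < n → CyclicUUVV U V i j k l → Separated n U V

Separated-swap : ∀ {n U V} → Separated n V U → Separated n U V
Separated-swap (separated i<j j<k k<l l<n p) = separated i<j j<k k<l l<n (CyclicUUVV-swap p)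

data Distinct3 {A : Set} (P : A → Set) : Set where
  distinct3 : ∀ {x y z} → x ≢ y → x ≢ z → y ≢ z → P x → P y → P z → Distinct3 P

Distinct3-pull : ∀ {A B : Set} {P : A → Set} {Q : B → Set} (f : B → A) →
  (∀ {x} → P x → ∃ λ b → Q b × f b ≡ x) → Distinct3 P → Distinct3 Q
Distinct3-pull f pull (distinct3 x≢y x≢z y≢z px py pz) with pull px | pull py | pull pz
... | a , qa , refl | b , qb , refl | c , qc , refl =
  distinct3 (x≢y ∘ cong f) (x≢z ∘ cong f) (y≢z ∘ cong f) qa qb qc

data Ascending (P : ℕ → Set) : Set where
  ascending : ∀ {p q r} → p < q → q < r → P p → P q → P r → Ascending P

Distinct3⇒Ascending : ∀ {P} → Distinct3 P → Ascending P
Distinct3⇒Ascending (distinct3 {a} {b} {c} a≢b a≢c b≢c pa pb pc) with <-cmp a b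
... | tri≈ _ a≡b _ = ⊥-elim (a≢b a≡b)
... | tri< a<b _ _ with <-cmp b c
...   | tri< b<c _ _ = ascending a<b b<c pa pb pc
...   | tri≈ _ b≡c _ = ⊥-elim (b≢c b≡c)
...   | tri> _ _ c<b with <-cmp a c
...     | tri< a<c _ _ = ascending a<c c<b pa pc pb
...     | tri≈ _ a≡c _ = ⊥-elim (a≢c a≡c)
...     | tri> _ _ c<a = ascending c<a a<b pc pa pb
Distinct3⇒Ascending (distinct3 {a} {b} {c} a≢b a≢c b≢c pa pb pc) | tri> _ _ b<a with <-cmp a c
...   | tri< a<c _ _ = ascending b<a a<c pb pa pc
...   | tri≈ _ a≡c _ = ⊥-elim (a≢c a≡c)
...   | tri> _ _ c<a with <-cmp b c
...     | tri< b<c _ _ = ascending b<c c<a pb pc pa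
...     | tri≈ _ b≡c _ = ⊥-elim (b≢c b≡c)
...     | tri> _ _ c<b = ascending c<b b<a pc pb pa

outside-three : ∀ {n d c e} → 4 ≤ n → d < c → c < e → ∃ λ w → w < n × w ≢ d × w ≢ c × w ≢ e
outside-three {d = suc _} 4≤n d<c c<e =
  0 , ≤-trans (s≤s z≤n) 4≤n , (λ ()) , <⇒≢ (<-trans z<s d<c) , <⇒≢ (<-trans (<-trans z<s d<c) c<e)
outside-three {d = 0} {c = suc (suc _)} 4≤n _ c<e =
  1 , ≤-trans (s≤s (s≤s z≤n)) 4≤n , (λ ()) , <⇒≢ (s<s z<s) , <⇒≢ (<-trans (s<s z<s) c<e)
outside-three {d = 0} {c = 1} {e = suc (suc (suc _))} 4≤n _ _ =
  2 , ≤-trans (s≤s (s≤s (s≤s z≤n))) 4≤n , (λ ()) , (λ ()) , <⇒≢ (s<s (s<s z<s))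
outside-three {d = 0} {c = 1} {e = 2} 4≤n _ _ = 3 , 4≤n , (λ ()) , (λ ()) , (λ ())
outside-three {d = 0} {c = 1} {e = 1} _ _ (s≤s ())
outside-three {d = 0} {c = 1} {e = 0} _ _ ()
outside-three {d = 0} {c = 0} _ () _

separated-with-fourth : ∀ {n U V d c e w} → d < c → c < e → e < n →
  U d × V d → U c × V c → U e × V e → w < n → w ≢ d → w ≢ c → w ≢ e → U w → Separated n U V
separated-with-fourth {d = d} {c} {e} {w} d<c c<e e<n (ud , vd) (uc , vc) (ue , ve) w<n w≢d w≢c w≢e uw
  with <-cmp w d
... | tri< w<d _ _ = separated w<d d<c c<e e<n (uuvv uw ud vc ve)
... | tri≈ _ w≡d _ = ⊥-elim (w≢d w≡d)
... | tri> _ _ d<w with <-cmp w c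
...   | tri< w<c _ _ = separated d<w w<c c<e e<n (uuvv ud uw vc ve)
...   | tri≈ _ w≡c _ = ⊥-elim (w≢c w≡c)
...   | tri> _ _ c<w with <-cmp w e
...     | tri< w<e _ _ = separated d<c c<w w<e e<n (vuuv vd uc uw ve)
...     | tri≈ _ w≡e _ = ⊥-elim (w≢e w≡e)
...     | tri> _ _ e<w = separated d<c c<e e<w w<n (vvuu vd vc ue uw)

-- Compare the middle U-position with the middle V-position; when they coincide compare
-- the first ones, then the last ones.  Only if the two triples are equal is a fourth
-- position needed, and n ≥ 4 provides it.
separated-from-triples : ∀ {n U V} → 4 ≤ n → (∀ t → t < n → U t ⊎ V t) →
  (∀ {t} → U t → t < n) → (∀ {t} → V t → t < n) → Ascending U → Ascending V → Separated n U V
separated-from-triples 4≤n cover U<n V<n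
  (ascending {p₁} {p₂} {p₃} p₁<p₂ p₂<p₃ up₁ up₂ up₃) (ascending {q₁} {q₂} {q₃} q₁<q₂ q₂<q₃ vq₁ vq₂ vq₃)
  with <-cmp p₂ q₂
... | tri< p₂<q₂ _ _ = separated p₁<p₂ p₂<q₂ q₂<q₃ (V<n vq₃) (uuvv up₁ up₂ vq₂ vq₃)
... | tri> _ _ q₂<p₂ = separated q₁<q₂ q₂<p₂ p₂<p₃ (U<n up₃) (vvuu vq₁ vq₂ up₂ up₃)
... | tri≈ _ refl _ with <-cmp p₁ q₁
...   | tri< p₁<q₁ _ _ = separated p₁<q₁ q₁<q₂ p₂<p₃ (U<n up₃) (uvvu up₁ vq₁ vq₂ up₃)
...   | tri> _ _ q₁<p₁ = separated q₁<p₁ p₁<p₂ q₂<q₃ (V<n vq₃) (vuuv vq₁ up₁ up₂ vq₃)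
...   | tri≈ _ refl _ with <-cmp p₃ q₃
...     | tri< p₃<q₃ _ _ = separated p₁<p₂ p₂<p₃ p₃<q₃ (V<n vq₃) (vuuv vq₁ up₂ up₃ vq₃)
...     | tri> _ _ q₃<p₃ = separated p₁<p₂ q₂<q₃ q₃<p₃ (U<n up₃) (uvvu up₁ vq₂ vq₃ up₃)
...     | tri≈ _ refl _ with outside-three 4≤n p₁<p₂ p₂<p₃
...       | w , w<n , w≢p₁ , w≢p₂ , w≢p₃ with cover w w<n
...         | inj₁ uw = separated-with-fourth p₁<p₂ p₂<p₃ (U<n up₃)
                          (up₁ , vq₁) (up₂ , vq₂) (up₃ , vq₃) w<n w≢p₁ w≢p₂ w≢p₃ uw
...         | inj₂ vw = Separated-swap (separated-with-fourth p₁<p₂ p₂<p₃ (U<n up₃)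
                          (vq₁ , up₁) (vq₂ , up₂) (vq₃ , up₃) w<n w≢p₁ w≢p₂ w≢p₃ vw)

-- Neighbours in a simple graph

Incident : ∀ {k} → Fin k → Edge k → Set
Incident w e = proj₁ e ≡ w ⊎ proj₂ e ≡ w

other : ∀ {k} → Fin k → Edge k → Fin k
other w (a , b) with a ≟ w
... | yes _ = b
... | no _  = a

edge-at-other : ∀ {k} {w : Fin k} e → Incident w e → EdgeEq e (w , other w e)
edge-at-other {w = w} (a , b) incident with a ≟ w
... | yes refl = inj₁ (refl , refl)
... | no a≢w   = inj₂ (refl , [ ⊥-elim ∘ a≢w , id ] incident)

EdgeEq-adj : ∀ {G : Graph} {x y} e → e ∈ edges G → EdgeEq e (x , y) → Adj G x y
EdgeEq-adj _ e∈G (inj₁ (refl , refl)) = inj₁ e∈G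
EdgeEq-adj _ e∈G (inj₂ (refl , refl)) = inj₂ e∈G

EdgeEq-loop : ∀ {k} {w : Fin k} e → EdgeEq e (w , w) → proj₁ e ≡ proj₂ e
EdgeEq-loop _ (inj₁ (refl , refl)) = refl
EdgeEq-loop _ (inj₂ (refl , refl)) = refl

EdgeEq-joint : ∀ {k} {e e' f : Edge k} → EdgeEq e f → EdgeEq e' f → EdgeEq e e'
EdgeEq-joint (inj₁ (refl , refl)) (inj₁ (refl , refl)) = inj₁ (refl , refl)
EdgeEq-joint (inj₁ (refl , refl)) (inj₂ (refl , refl)) = inj₂ (refl , refl)
EdgeEq-joint (inj₂ (refl , refl)) (inj₁ (refl , refl)) = inj₂ (refl , refl)
EdgeEq-joint (inj₂ (refl , refl)) (inj₂ (refl , refl)) = inj₁ (refl , refl)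

Simple⇒nonParallel : ∀ {G} → Simple G → AllPairs (λ e f → ¬ EdgeEq e f) (edges G)
Simple⇒nonParallel {G} (_ , nonParallel) =
  subst (AllPairs _) (tabulate-lookup (edges G)) (AllPairs.tabulate⁺ (nonParallel _ _))

AllPairs-restrict : ∀ {A : Set} {P : A → Set} {R S : A → A → Set} →
  (∀ {x y} → P x → P y → R x y → S x y) → ∀ {xs} → All P xs → AllPairs R xs → AllPairs S xs
AllPairs-restrict f []         []         = []
AllPairs-restrict f (px ∷ pxs) (rx ∷ rxs) =
  All.zipWith (λ (py , r) → f px py r) (pxs , rx) ∷ AllPairs-restrict f pxs rxs

incidentEdges : (G : Graph) → Fin (N G) → List (Edge (N G))
incidentEdges G w = filter (λ e → (proj₁ e ≟ w) ⊎-dec (proj₂ e ≟ w)) (edges G)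

neighbours : (G : Graph) → Fin (N G) → List (Fin (N G))
neighbours G w = map (other w) (incidentEdges G w)

module _ {G : Graph} (simple : Simple G) (w : Fin (N G)) where

  incidentEdges-sound : All (λ e → e ∈ edges G × Incident w e) (incidentEdges G w)
  incidentEdges-sound = All.tabulate (∈-filter⁻ (λ e → (proj₁ e ≟ w) ⊎-dec (proj₂ e ≟ w)))

  neighbours-adjacent : All (λ o → Adj G w o × o ≢ w) (neighbours G w)
  neighbours-adjacent = All.map⁺ (All.map adjacent incidentEdges-sound)
    where
    adjacent : ∀ {e} → e ∈ edges G × Incident w e → Adj G w (other w e) × other w e ≢ w
    adjacent {e} (e∈G , incident) =
      EdgeEq-adj e e∈G at , λ o≡w → proj₁ simple _ _ e∈G (EdgeEq-loop e (subst (λ o → EdgeEq e (w , o)) o≡w at))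
      where at = edge-at-other e incident

  neighbours-unique : Unique (neighbours G w)
  neighbours-unique = AllPairs.map⁺ (AllPairs-restrict apart incidentEdges-sound
    (AllPairs.filter⁺ (λ e → (proj₁ e ≟ w) ⊎-dec (proj₂ e ≟ w)) (Simple⇒nonParallel simple)))
    where
    apart : ∀ {e f} → e ∈ edges G × Incident w e → f ∈ edges G × Incident w f →
      ¬ EdgeEq e f → other w e ≢ other w f
    apart {e} {f} (_ , ie) (_ , if) ¬e≈f oe≡of =
      ¬e≈f (EdgeEq-joint (edge-at-other e ie) (subst (λ o → EdgeEq f (w , o)) (sym oe≡of) (edge-at-other f if)))

three-avoiding : ∀ {A : Set} {P : A → Set} → DecidableEquality A → (y : A) →
  ∀ {xs} → Unique xs → All P xs → 4 ≤ length xs → Distinct3 (λ x → P x × x ≢ y)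
three-avoiding _≟′_ y {a ∷ b ∷ c ∷ _ ∷ _}
  ((a≢b ∷ a≢c ∷ a≢d ∷ _) ∷ (b≢c ∷ b≢d ∷ _) ∷ (c≢d ∷ _) ∷ _) (pa ∷ pb ∷ pc ∷ pd ∷ _) _
  with a ≟′ y | b ≟′ y | c ≟′ y
... | yes refl | _        | _        = distinct3 b≢c b≢d c≢d (pb , a≢b ∘ sym) (pc , a≢c ∘ sym) (pd , a≢d ∘ sym)
... | no a≢y   | yes refl | _        = distinct3 a≢c a≢d c≢d (pa , a≢y) (pc , b≢c ∘ sym) (pd , b≢d ∘ sym)
... | no a≢y   | no b≢y   | yes refl = distinct3 a≢b a≢d b≢d (pa , a≢y) (pb , b≢y) (pd , c≢d ∘ sym)
... | no a≢y   | no b≢y   | no c≢y   = distinct3 a≢b a≢c b≢c (pa , a≢y) (pb , b≢y) (pc , c≢y)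
three-avoiding _ _ {[]}                  _ _ ()
three-avoiding _ _ {_ ∷ []}              _ _ (s≤s ())
three-avoiding _ _ {_ ∷ _ ∷ []}          _ _ (s≤s (s≤s ()))
three-avoiding _ _ {_ ∷ _ ∷ _ ∷ []}      _ _ (s≤s (s≤s (s≤s ())))

three-neighbours : ∀ {G} → Simple G → (w w' : Fin (N G)) → 4 ≤ degree G w →
  Distinct3 (λ o → (Adj G w o × o ≢ w) × o ≢ w')
three-neighbours {G} simple w w' 4≤deg =
  three-avoiding _≟_ w' (neighbours-unique simple w) (neighbours-adjacent simple w)
    (subst (4 ≤_) (sym (length-map (other w) (incidentEdges G w))) 4≤deg)

-- Contracting the split edge

Pointwise-∈ʳ : ∀ {A B : Set} {R : A → B → Set} {xs ys} → Pointwise R xs ys →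
  ∀ {y} → y ∈ ys → ∃ λ x → x ∈ xs × R x y
Pointwise-∈ʳ (r ∷ _)  (here refl) = _ , here refl , r
Pointwise-∈ʳ (_ ∷ rs) (there y∈ys) with Pointwise-∈ʳ rs y∈ys
... | x , x∈xs , r = x , there x∈xs , r

module Contraction {H F : Graph} {w : Fin (N F)} {u v : Fin (N H)}
  (rest : List (Edge (N H))) (perm : edges H ↭ ((u , v) ∷ rest))
  (φ : Fin (N H) → Fin (N F)) (φu : φ u ≡ w) (φv : φ v ≡ w)
  (φ-inj : ∀ x y → φ x ≡ φ y → (x ≡ y) ⊎ ((x ≡ u ⊎ x ≡ v) × (y ≡ u ⊎ y ≡ v)))
  (same : SameEdgeMultiset (map (λ e → (φ (proj₁ e) , φ (proj₂ e))) rest) (edges F))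
  where

  lift-edge : ∀ {a b} → (a , b) ∈ edges F → ∃ λ x → ∃ λ y → φ x ≡ a × φ y ≡ b × Adj H x y
  lift-edge ab∈F with Pointwise-∈ʳ (proj₂ (proj₂ same)) ab∈F
  ... | _ , e∈zs , e≈ab with ∈-map⁻ _ (∈-resp-↭ (↭-sym (proj₁ (proj₂ same))) e∈zs)
  ...   | (x , y) , xy∈rest , refl = oriented e≈ab
    where
    xy∈H : (x , y) ∈ edges H
    xy∈H = ∈-resp-↭ (↭-sym perm) (there xy∈rest)
    oriented : ∀ {a b} → EdgeEq (φ x , φ y) (a , b) → ∃ λ x' → ∃ λ y' → φ x' ≡ a × φ y' ≡ b × Adj H x' y'
    oriented (inj₁ (refl , refl)) = x , y , refl , refl , inj₁ xy∈H
    oriented (inj₂ (refl , refl)) = y , x , refl , refl , inj₂ xy∈H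

  hub-fibre : ∀ {x} → φ x ≡ w → x ≡ u ⊎ x ≡ v
  hub-fibre {x} φx≡w with φ-inj x u (trans φx≡w (sym φu))
  ... | inj₁ x≡u       = inj₁ x≡u
  ... | inj₂ (x∈uv , _) = x∈uv

  φ-split : ∀ {x} → x ≡ u ⊎ x ≡ v → φ x ≡ w
  φ-split (inj₁ refl) = φu
  φ-split (inj₂ refl) = φv

  fibre-unique : ∀ {x y a} → φ x ≡ a → φ y ≡ a → a ≢ w → x ≡ y
  fibre-unique {x} {y} φx≡a φy≡a a≢w with φ-inj x y (trans φx≡a (sym φy≡a))
  ... | inj₁ x≡y        = x≡y
  ... | inj₂ (x∈uv , _) = ⊥-elim (a≢w (trans (sym φx≡a) (φ-split x∈uv)))

-- The split wheel

toℕ-nextRim : ∀ {m} (a : Fin (suc m)) → toℕ (nextRim a) ≡ suc (toℕ a) % suc m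
toℕ-nextRim {m} a with suc (toℕ a) <? suc m
... | yes 1+a<n = trans (toℕ-fromℕ< 1+a<n) (sym (m<n⇒m%n≡m 1+a<n))
... | no 1+a≮n  = sym (trans (cong (_% suc m) (≤∧≮⇒≡ (toℕ<n a) 1+a≮n)) (n%n≡0 (suc m)))

suc-% : ∀ t n .{{_ : NonZero n}} → suc t % n ≡ suc (t % n) % n
suc-% t n = begin
  (1 + t) % n              ≡⟨ %-distribˡ-+ 1 t n ⟩
  (1 % n + t % n) % n      ≡⟨ cong (λ r → (1 % n + r) % n) (m%n%n≡m%n t n) ⟨
  (1 % n + t % n % n) % n  ≡⟨ %-distribˡ-+ 1 (t % n) n ⟨
  (1 + t % n) % n          ∎
  where open ≡-Reasoning

nextRim-mod : ∀ {m} t → nextRim (t mod suc m) ≡ suc t mod suc m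
nextRim-mod {m} t = toℕ-injective (begin
  toℕ (nextRim (t mod n))    ≡⟨ toℕ-nextRim (t mod n) ⟩
  suc (toℕ (t mod n)) % n    ≡⟨ cong (λ r → suc r % n) (toℕ-fromℕ< _) ⟩
  suc (t % n) % n            ≡⟨ suc-% t n ⟨
  suc t % n                  ≡⟨ toℕ-fromℕ< _ ⟨
  toℕ (suc t mod n)          ∎)
  where
  open ≡-Reasoning
  n = suc m

toℕ-mod-below : ∀ {t m} → t < suc m → toℕ (t mod suc m) ≡ t
toℕ-mod-below t<n = trans (toℕ-fromℕ< _) (m<n⇒m%n≡m t<n)

module SplitWheel
  (G : Graph) (u v : Fin (N G)) (m : ℕ) (D : Fin (suc m) → Bool)
  (rest : List (Edge (N G))) (perm : edges G ↭ ((u , v) ∷ rest))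
  (φ : Fin (N G) → Fin (suc (suc m))) (φu : φ u ≡ hub) (φv : φ v ≡ hub)
  (φ-inj : ∀ x y → φ x ≡ φ y → (x ≡ y) ⊎ ((x ≡ u ⊎ x ≡ v) × (y ≡ u ⊎ y ≡ v)))
  (φ-onto : ∀ z → ∃ λ x → φ x ≡ z)
  (same : SameEdgeMultiset (map (λ e → (φ (proj₁ e) , φ (proj₂ e))) rest) (edges (wheelDoubled (suc m) D)))
  where

  open Contraction rest perm φ φu φv φ-inj same

  n : ℕ
  n = suc m

  rim : Fin n → Fin (N G)
  rim a = proj₁ (φ-onto (suc a))

  φ-rim : ∀ a → φ (rim a) ≡ suc a
  φ-rim a = proj₂ (φ-onto (suc a))

  rim-unique : ∀ {x a} → φ x ≡ suc a → x ≡ rim a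
  rim-unique φx≡a = fibre-unique φx≡a (φ-rim _) (λ ())

  rim-adjacent : ∀ a → Adj G (rim a) (rim (nextRim a))
  rim-adjacent a with lift-edge (∈-++⁺ˡ (∈-map⁺ (λ i → (suc i , suc (nextRim i))) (∈-allFin a)))
  ... | _ , _ , φx , φy , x~y = subst₂ (Adj G) (rim-unique φx) (rim-unique φy) x~y

  rim-spoke : ∀ a → Adj G u (rim a) ⊎ Adj G v (rim a)
  rim-spoke a with lift-edge (∈-++⁺ʳ (rimEdges n) (∈-++⁺ˡ (∈-map⁺ (λ i → (hub , suc i)) (∈-allFin a))))
  ... | _ , _ , φx , φy , x~y with hub-fibre φx
  ...   | inj₁ refl = inj₁ (subst (Adj G u) (rim-unique φy) x~y)
  ...   | inj₂ refl = inj₂ (subst (Adj G v) (rim-unique φy) x~y)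

  rimAt : ℕ → Fin (N G)
  rimAt t = rim (t mod n)

  rimAt-adjacent : ∀ t → Adj G (rimAt t) (rimAt (suc t))
  rimAt-adjacent t = subst (λ b → Adj G (rimAt t) (rim b)) (nextRim-mod t) (rim-adjacent (t mod n))

  rimAt-wrap : rimAt 0 ≡ rimAt n
  rimAt-wrap = cong rim (toℕ-injective (sym (trans (toℕ-fromℕ< _) (n%n≡0 n))))

  rimAt-injective : ∀ {s t} → s < n → t < n → rimAt s ≡ rimAt t → s ≡ t
  rimAt-injective {s} {t} s<n t<n e = begin
    s                ≡⟨ toℕ-mod-below s<n ⟨
    toℕ (s mod n)    ≡⟨ cong toℕ (suc-injective (trans (sym (φ-rim _)) (trans (cong φ e) (φ-rim _)))) ⟩
    toℕ (t mod n)    ≡⟨ toℕ-mod-below t<n ⟩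
    t                ∎
    where open ≡-Reasoning

  rimAt≢ : ∀ {t x} → φ x ≡ hub → rimAt t ≢ x
  rimAt≢ φx≡hub refl with trans (sym (φ-rim _)) φx≡hub
  ... | ()

  rim-position : ∀ {x} → x ≢ u → x ≢ v → ∃ λ t → t < n × rimAt t ≡ x
  rim-position {x} x≢u x≢v with φ x in φx
  ... | zero  = ⊥-elim ([ x≢u , x≢v ] (hub-fibre φx))
  ... | suc a = toℕ a , toℕ<n a , trans (cong rim (toℕ-injective (toℕ-mod-below (toℕ<n a)))) (sym (rim-unique φx))

  Spoke : Fin (N G) → ℕ → Set
  Spoke w t = t < n × Adj G w (rimAt t)

  spoke-position : ∀ {w o} → Adj G w o → o ≢ u → o ≢ v → ∃ λ t → Spoke w t × rimAt t ≡ o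
  spoke-position {w} w~o o≢u o≢v with rim-position o≢u o≢v
  ... | t , t<n , refl = t , (t<n , w~o) , refl

  Arc : ℕ → ℕ → Fin (N G) → Set
  Arc = Segment rimAt

  on-arc : ∀ {lo hi t} → lo ≤ t → t ≤ hi → Arc lo hi (rimAt t)
  on-arc lo≤t t≤hi = _ , lo≤t , t≤hi , refl

  arc-avoids : ∀ {lo hi x} → Arc lo hi x → x ≢ u × x ≢ v
  arc-avoids (t , _ , _ , refl) = rimAt≢ {t} φu , rimAt≢ {t} φv

  arcs-apart : ∀ {lo hi lo' hi' x} → hi < lo' → hi' < n → Arc lo hi x → Arc lo' hi' x → ⊥
  arcs-apart hi<lo' hi'<n (s , _ , s≤hi , refl) (t , lo'≤t , t≤hi' , rimAt-t≡s) =
    <-irrefl (rimAt-injective (<-trans s<t t<n) t<n (sym rimAt-t≡s)) s<t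
    where
    s<t = ≤-<-trans s≤hi (<-≤-trans hi<lo' lo'≤t)
    t<n = ≤-<-trans t≤hi' hi'<n

  arcs-linked : ∀ {lo hi lo' hi' t} → lo ≤ t → t ≤ hi → lo' ≤ suc t → suc t ≤ hi' →
    Linked G (Arc lo hi) (Arc lo' hi')
  arcs-linked {t = t} lo≤t t≤hi lo'≤1+t 1+t≤hi' =
    rimAt t , rimAt (suc t) , on-arc lo≤t t≤hi , on-arc lo'≤1+t 1+t≤hi' , rimAt-adjacent t

  arc-touches : ∀ {w lo hi t} → Spoke w t → lo ≤ t → t ≤ hi → Touches G w (Arc lo hi)
  arc-touches (_ , w~t) lo≤t t≤hi = _ , on-arc lo≤t t≤hi , w~t

  arc-connected : ∀ lo hi → ConnectedSet G (Arc lo hi)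
  arc-connected = segment-connected G rimAt rimAt-adjacent

  module _ {i j k : ℕ} (i<j : i < j) (j<k : j < k) (k<m : k < m) where

    arc : Fin 4 → Fin (N G) → Set
    arc 0F = Arc 0 i
    arc 1F = Arc (suc i) j
    arc 2F = Arc (suc j) k
    arc 3F = Arc (suc k) m

    m<n : m < n
    m<n = n<1+n m

    k<n : k < n
    k<n = <-trans k<m m<n

    j<n : j < n
    j<n = <-trans j<k k<n

    arc-disjoint : ∀ a b x → arc a x → arc b x → a ≡ b
    arc-disjoint 0F 0F _ _ _ = refl
    arc-disjoint 1F 1F _ _ _ = refl
    arc-disjoint 2F 2F _ _ _ = refl
    arc-disjoint 3F 3F _ _ _ = refl
    arc-disjoint 0F 1F _ p q = ⊥-elim (arcs-apart (n<1+n i) j<n p q)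
    arc-disjoint 1F 0F _ p q = ⊥-elim (arcs-apart (n<1+n i) j<n q p)
    arc-disjoint 0F 2F _ p q = ⊥-elim (arcs-apart (m<n⇒m<1+n i<j) k<n p q)
    arc-disjoint 2F 0F _ p q = ⊥-elim (arcs-apart (m<n⇒m<1+n i<j) k<n q p)
    arc-disjoint 0F 3F _ p q = ⊥-elim (arcs-apart (m<n⇒m<1+n (<-trans i<j j<k)) m<n p q)
    arc-disjoint 3F 0F _ p q = ⊥-elim (arcs-apart (m<n⇒m<1+n (<-trans i<j j<k)) m<n q p)
    arc-disjoint 1F 2F _ p q = ⊥-elim (arcs-apart (n<1+n j) k<n p q)
    arc-disjoint 2F 1F _ p q = ⊥-elim (arcs-apart (n<1+n j) k<n q p)
    arc-disjoint 1F 3F _ p q = ⊥-elim (arcs-apart (m<n⇒m<1+n j<k) m<n p q)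
    arc-disjoint 3F 1F _ p q = ⊥-elim (arcs-apart (m<n⇒m<1+n j<k) m<n q p)
    arc-disjoint 2F 3F _ p q = ⊥-elim (arcs-apart (n<1+n k) m<n p q)
    arc-disjoint 3F 2F _ p q = ⊥-elim (arcs-apart (n<1+n k) m<n q p)

    arcNecklace : Necklace G u v
    arcNecklace = record
      { bead      = arc
      ; nonempty  = λ { 0F → _ , on-arc z≤n ≤-refl ; 1F → _ , on-arc i<j ≤-refl
                      ; 2F → _ , on-arc j<k ≤-refl ; 3F → _ , on-arc k<m ≤-refl }
      ; connected = λ { 0F → arc-connected _ _ ; 1F → arc-connected _ _
                      ; 2F → arc-connected _ _ ; 3F → arc-connected _ _ }
      ; disjoint  = arc-disjoint
      ; avoids    = λ { 0F _ → arc-avoids ; 1F _ → arc-avoids ; 2F _ → arc-avoids ; 3F _ → arc-avoids }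
      ; linked    = λ { 0F → arcs-linked z≤n ≤-refl ≤-refl i<j
                      ; 1F → arcs-linked i<j ≤-refl ≤-refl j<k
                      ; 2F → arcs-linked j<k ≤-refl ≤-refl k<m
                      ; 3F → rimAt m , rimAt 0 , on-arc k<m ≤-refl , on-arc z≤n z≤n ,
                             subst (Adj G (rimAt m)) (sym rimAt-wrap) (rimAt-adjacent m) }
      }

  separated⇒prism : u ≢ v → Adj G u v → Separated n (Spoke u) (Spoke v) → HasMinorUsing prism G u v
  separated⇒prism u≢v u~v (separated {i} {j} {k} {l} i<j j<k k<l l<n uuvv-pattern) = from uuvv-pattern
    where
    k<m : k < m
    k<m = <-≤-trans k<l (≤-pred l<n)

    necklace : Necklace G u v
    necklace = arcNecklace i<j j<k k<m

    at-i : ∀ {w} → Spoke w i → Touches G w (Arc 0 i)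
    at-i s = arc-touches s z≤n ≤-refl
    at-j : ∀ {w} → Spoke w j → Touches G w (Arc (suc i) j)
    at-j s = arc-touches s i<j ≤-refl
    at-k : ∀ {w} → Spoke w k → Touches G w (Arc (suc j) k)
    at-k s = arc-touches s j<k ≤-refl
    at-l : ∀ {w} → Spoke w l → Touches G w (Arc (suc k) m)
    at-l s = arc-touches s k<l (≤-pred l<n)

    from : CyclicUUVV (Spoke u) (Spoke v) i j k l → HasMinorUsing prism G u v
    from (uuvv ui uj vk vl) = necklace⇒prism necklace u≢v u~v (at-i ui) (at-j uj) (at-k vk) (at-l vl)
    from (vuuv vi uj uk vl) = necklace⇒prism (rotate necklace) u≢v u~v (at-j uj) (at-k uk) (at-l vl) (at-i vi)
    from (vvuu vi vj uk ul) = necklace⇒prism (rotate (rotate necklace)) u≢v u~v (at-k uk) (at-l ul) (at-i vi) (at-j vj)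
    from (uvvu ui vj vk ul) = necklace⇒prism (rotate (rotate (rotate necklace))) u≢v u~v (at-l ul) (at-i ui) (at-j vj) (at-k vk)

  prism-minor : Simple G → u ≢ v → Adj G u v → 4 ≤ n → 4 ≤ degree G u → 4 ≤ degree G v →
    HasMinorUsing prism G u v
  prism-minor simple u≢v u~v 4≤n 4≤deg-u 4≤deg-v =
    separated⇒prism u≢v u~v (separated-from-triples 4≤n spoke-cover proj₁ proj₁ spokes-u spokes-v)
    where
    spoke-cover : ∀ t → t < n → Spoke u t ⊎ Spoke v t
    spoke-cover t t<n = Sum.map (t<n ,_) (t<n ,_) (rim-spoke (t mod n))

    spokes-u : Ascending (Spoke u)
    spokes-u = Distinct3⇒Ascending (Distinct3-pull rimAt
      (λ ((u~o , o≢u) , o≢v) → spoke-position u~o o≢u o≢v) (three-neighbours simple u v 4≤deg-u))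

    spokes-v : Ascending (Spoke v)
    spokes-v = Distinct3⇒Ascending (Distinct3-pull rimAt
      (λ ((v~o , o≢v) , o≢u) → spoke-position v~o o≢u o≢v) (three-neighbours simple v u 4≤deg-v))

lemma6p2 : (G : Graph) → (u v : Fin (N G)) →
    ThreeConnected G → 6 ≤ N G → (u , v) ∈ edges G →
    (n : ℕ) → 4 ≤ n → (D : Fin n → Bool) →
    SplitBy G (wheelDoubled n D) hub u v →
    4 ≤ degree G u → 4 ≤ degree G v →
    HasMinorUsing prism G u v
lemma6p2 G u v _ _ _ zero () _ _ _ _
lemma6p2 G u v (simple , _) _ uv∈G (suc m) 4≤n D (u≢v , rest , perm , φ , φu , φv , φ-inj , φ-onto , same) 4≤deg-u 4≤deg-v =
  SplitWheel.prism-minor G u v m D rest perm φ φu φv φ-inj φ-onto same simple u≢v (inj₁ uv∈G) 4≤n 4≤deg-u 4≤deg-v
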